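{- Let $\xi$ and $r$ be relatively prime integers with $r\ge2$ and $0<\xi\le r/2$. Then the marked pyramid $P^{\xi}_r$ is integer-affine equivalent to the marked pyramid $T^{\xi}_{1,r}$.
   Context: $P^{\xi}_r$ is the marked pyramid with vertex $(0,0,0)$ and base triangle $(0,1,0),(1,0,0),(\xi,r-\xi,r)$. $T^{\xi}_{a,r}$ is the marked pyramid with vertex $(0,0,0)$ and base triangle $(\xi,r-1,-r),(a+\xi,r-1,-r),(\xi,r,-r)$. Integer-affine equivalence of marked pyramids: an affine automorphism of $\mathbb R^3$ preserving $\mathbb Z^3$ mapping one onto the other, vertex to vertex. -}

module Defs where

open import Data.Nat using (ℕ)
open import Data.Integer using (ℤ; +_; _+_; _-_; _*_; -_)
open import Data.Fin using (Fin; zero; suc)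
open import Data.Fin.Permutation using (Permutation′; _⟨$⟩ʳ_)
open import Data.Product using (Σ; _×_; ∃)
open import Relation.Binary.PropositionalEquality using (_≡_)

record V3 : Set where
  constructor v3
  field
    x y z : ℤ
open V3 public

_+ᵥ_ : V3 → V3 → V3
v3 a b c +ᵥ v3 d e f = v3 (a + d) (b + e) (c + f)

dot : V3 → V3 → ℤ
dot (v3 a b c) (v3 d e f) = a * d + b * e + c * f

record M3 : Set where
  constructor m3
  field
    row₁ row₂ row₃ : V3
open M3 public

col₁ col₂ col₃ : M3 → V3
col₁ (m3 r s t) = v3 (x r) (x s) (x t)
col₂ (m3 r s t) = v3 (y r) (y s) (y t)
col₃ (m3 r s t) = v3 (z r) (z s) (z t)

_·ᵥ_ : M3 → V3 → V3
m3 r s t ·ᵥ v = v3 (dot r v) (dot s v) (dot t v)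

_·ₘ_ : M3 → M3 → M3
m3 r s t ·ₘ B = m3 (rowTimes r) (rowTimes s) (rowTimes t)
  where
  rowTimes : V3 → V3
  rowTimes u = v3 (dot u (col₁ B)) (dot u (col₂ B)) (dot u (col₃ B))

I₃ : M3
I₃ = m3 (v3 (+ 1) (+ 0) (+ 0)) (v3 (+ 0) (+ 1) (+ 0)) (v3 (+ 0) (+ 0) (+ 1))

-- An integer-affine automorphism of ℝ³ (affine automorphism preserving ℤ³):
-- x ↦ A x + b with A ∈ GL₃(ℤ) (integer matrix with an integer inverse) and b ∈ ℤ³.
record IntAffAut : Set where
  constructor intAffAut
  field
    A    : M3
    Ainv : M3
    b    : V3
    invˡ : Ainv ·ₘ A ≡ I₃
    invʳ : A ·ₘ Ainv ≡ I₃
open IntAffAut public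

apply : IntAffAut → V3 → V3
apply f p = (A f ·ᵥ p) +ᵥ b f

-- A marked pyramid: the convex hull of a marked vertex (apex) and a base triangle,
-- recorded by its lattice vertices.
record MarkedPyramid : Set where
  constructor pyramid
  field
    apex : V3
    base : Fin 3 → V3
open MarkedPyramid public

-- Integer-affine equivalence of marked pyramids: an integer-affine automorphism
-- sending apex to apex and the vertices of the base triangle onto the vertices of
-- the other base triangle (hence the pyramid onto the pyramid, vertex to vertex).
_≅ᵢₐ_ : MarkedPyramid → MarkedPyramid → Set
P ≅ᵢₐ Q = Σ IntAffAut λ f →
  (apply f (apex P) ≡ apex Q) ×
  Σ (Permutation′ 3) λ σ → ∀ i → apply f (base P i) ≡ base Q (σ ⟨$⟩ʳ i)

origin : V3
origin = v3 (+ 0) (+ 0) (+ 0)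

tri : V3 → V3 → V3 → Fin 3 → V3
tri p q r zero = p
tri p q r (suc zero) = q
tri p q r (suc (suc zero)) = r

P[_,_] : ℤ → ℤ → MarkedPyramid
P[ ξ , r ] = pyramid origin
  (tri (v3 (+ 0) (+ 1) (+ 0)) (v3 (+ 1) (+ 0) (+ 0)) (v3 ξ (r - ξ) r))

T[_,_,_] : ℤ → ℤ → ℤ → MarkedPyramid
T[ ξ , a , r ] = pyramid origin
  (tri (v3 ξ (r - + 1) (- r)) (v3 (a + ξ) (r - + 1) (- r)) (v3 ξ r (- r)))

{-# OPTIONS --safe #-}
module Submission where

open import Defs
open import Data.Nat using (ℕ; _≤_; _*_)
open import Data.Nat.Coprimality using (Coprime)
open import Data.Integer as ℤ using (ℤ; +_; _+_; _-_; -_)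
open import Data.Integer.Properties using (+-identityʳ; *-comm)
open import Data.Integer.Tactic.RingSolver using (solve-∀)
open import Data.Fin using (zero; suc)
open import Data.Fin.Permutation using (id)
open import Data.Product using (_,_)
open import Relation.Binary.PropositionalEquality using (_≡_; refl; sym; trans; cong; cong₂; module ≡-Reasoning)

-- The linear map with matrix
--   L = [[1 + ξ, ξ, -ξ], [r - 1, r - 1, 2 - r], [-r, -r, r - 1]]
-- fixes the apex and sends the base vertices (0,1,0), (1,0,0), (ξ, r - ξ, r) of P^ξ_r in
-- order to the base vertices (ξ, r - 1, -r), (1 + ξ, r - 1, -r), (ξ, r, -r) of T^ξ_{1,r}:
-- its first two columns are dictated by the first two vertices, and its third column is
-- then forced by the third one.  Since det L = 1, the adjugate of L is an integral inverse.

v3-cong : ∀ {a b c a′ b′ c′} → a ≡ a′ → b ≡ b′ → c ≡ c′ → v3 a b c ≡ v3 a′ b′ c′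
v3-cong refl refl refl = refl

m3-cong : ∀ {u v w u′ v′ w′} → u ≡ u′ → v ≡ v′ → w ≡ w′ → m3 u v w ≡ m3 u′ v′ w′
m3-cong refl refl refl = refl

e₁ e₂ : V3
e₁ = v3 (+ 1) (+ 0) (+ 0)
e₂ = v3 (+ 0) (+ 1) (+ 0)

cross : V3 → V3 → V3
cross (v3 a b c) (v3 d e f) = v3 (b ℤ.* f - c ℤ.* e) (c ℤ.* d - a ℤ.* f) (a ℤ.* e - b ℤ.* d)

dot-comm : ∀ u v → dot u v ≡ dot v u
dot-comm (v3 a b c) (v3 d e f) =
  cong₂ _+_ (cong₂ _+_ (*-comm a d) (*-comm b e)) (*-comm c f)

-- The ring solver does not unfold dot and cross, so its identities below are stated in
-- the unfolded shape of the goal.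
dot-origin : ∀ u → dot u origin ≡ + 0
dot-origin (v3 a b c) = identity a b c
  where
  identity : ∀ a b c → a ℤ.* + 0 + b ℤ.* + 0 + c ℤ.* + 0 ≡ + 0
  identity = solve-∀

dot-e₁ : ∀ u → dot u e₁ ≡ x u
dot-e₁ (v3 a b c) = identity a b c
  where
  identity : ∀ a b c → a ℤ.* + 1 + b ℤ.* + 0 + c ℤ.* + 0 ≡ a
  identity = solve-∀

dot-e₂ : ∀ u → dot u e₂ ≡ y u
dot-e₂ (v3 a b c) = identity a b c
  where
  identity : ∀ a b c → a ℤ.* + 0 + b ℤ.* + 1 + c ℤ.* + 0 ≡ b
  identity = solve-∀

dot-cross-selfˡ : ∀ u v → dot u (cross u v) ≡ + 0
dot-cross-selfˡ (v3 a b c) (v3 d e f) = identity a b c d e f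
  where
  identity : ∀ a b c d e f →
    a ℤ.* (b ℤ.* f - c ℤ.* e) + b ℤ.* (c ℤ.* d - a ℤ.* f) + c ℤ.* (a ℤ.* e - b ℤ.* d) ≡ + 0
  identity = solve-∀

dot-cross-selfʳ : ∀ u v → dot v (cross u v) ≡ + 0
dot-cross-selfʳ (v3 a b c) (v3 d e f) = identity a b c d e f
  where
  identity : ∀ a b c d e f →
    d ℤ.* (b ℤ.* f - c ℤ.* e) + e ℤ.* (c ℤ.* d - a ℤ.* f) + f ℤ.* (a ℤ.* e - b ℤ.* d) ≡ + 0
  identity = solve-∀

dot-cross-rotate : ∀ u v w → dot u (cross v w) ≡ dot v (cross w u)
dot-cross-rotate (v3 a b c) (v3 d e f) (v3 g h i) = identity a b c d e f g h i
  where
  identity : ∀ a b c d e f g h i →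
    a ℤ.* (e ℤ.* i - f ℤ.* h) + b ℤ.* (f ℤ.* g - d ℤ.* i) + c ℤ.* (d ℤ.* h - e ℤ.* g) ≡
    d ℤ.* (h ℤ.* c - i ℤ.* b) + e ℤ.* (i ℤ.* a - g ℤ.* c) + f ℤ.* (g ℤ.* b - h ℤ.* a)
  identity = solve-∀

transpose : M3 → M3
transpose M = m3 (col₁ M) (col₂ M) (col₃ M)

transpose-·ₘ : ∀ M N → transpose (M ·ₘ N) ≡ transpose N ·ₘ transpose M
transpose-·ₘ (m3 r₁ r₂ r₃) N =
  m3-cong (v3-cong (dot-comm r₁ (col₁ N)) (dot-comm r₂ (col₁ N)) (dot-comm r₃ (col₁ N)))
          (v3-cong (dot-comm r₁ (col₂ N)) (dot-comm r₂ (col₂ N)) (dot-comm r₃ (col₂ N)))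
          (v3-cong (dot-comm r₁ (col₃ N)) (dot-comm r₂ (col₃ N)) (dot-comm r₃ (col₃ N)))

scalar : ℤ → M3
scalar k = m3 (v3 k (+ 0) (+ 0)) (v3 (+ 0) k (+ 0)) (v3 (+ 0) (+ 0) k)

det : M3 → ℤ
det (m3 r₁ r₂ r₃) = dot r₁ (cross r₂ r₃)

adj : M3 → M3
adj (m3 r₁ r₂ r₃) = transpose (m3 (cross r₂ r₃) (cross r₃ r₁) (cross r₁ r₂))

det-transpose : ∀ M → det (transpose M) ≡ det M
det-transpose (m3 (v3 a b c) (v3 d e f) (v3 g h i)) = identity a b c d e f g h i
  where
  identity : ∀ a b c d e f g h i →
    a ℤ.* (e ℤ.* i - h ℤ.* f) + d ℤ.* (h ℤ.* c - b ℤ.* i) + g ℤ.* (b ℤ.* f - e ℤ.* c) ≡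
    a ℤ.* (e ℤ.* i - f ℤ.* h) + b ℤ.* (f ℤ.* g - d ℤ.* i) + c ℤ.* (d ℤ.* h - e ℤ.* g)
  identity = solve-∀

adj-transpose : ∀ M → adj (transpose M) ≡ transpose (adj M)
adj-transpose (m3 (v3 a b c) (v3 d e f) (v3 g h i)) =
  m3-cong (v3-cong (swap e i h f) (swap f g i d) (swap d h g e))
          (v3-cong (swap h c b i) (swap i a c g) (swap g b a h))
          (v3-cong (swap b f e c) (swap c d f a) (swap a e d b))
  where
  swap : ∀ p q s t → p ℤ.* q - s ℤ.* t ≡ p ℤ.* q - t ℤ.* s
  swap p q s t = cong (_-_ (p ℤ.* q)) (*-comm s t)

·ₘ-adj : ∀ M → M ·ₘ adj M ≡ scalar (det M)
·ₘ-adj (m3 r₁ r₂ r₃) =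
  m3-cong (v3-cong refl (dot-cross-selfʳ r₃ r₁) (dot-cross-selfˡ r₁ r₂))
          (v3-cong (dot-cross-selfˡ r₂ r₃) (sym (dot-cross-rotate r₁ r₂ r₃)) (dot-cross-selfʳ r₁ r₂))
          (v3-cong (dot-cross-selfʳ r₂ r₃) (dot-cross-selfˡ r₃ r₁) (dot-cross-rotate r₃ r₁ r₂))

-- The first step uses that transpose is involutive up to η for records, i.e. definitionally.
adj-·ₘ : ∀ M → adj M ·ₘ M ≡ scalar (det M)
adj-·ₘ M = begin
  adj M ·ₘ M
    ≡⟨ sym (transpose-·ₘ (transpose M) (transpose (adj M))) ⟩
  transpose (transpose M ·ₘ transpose (adj M))
    ≡⟨ cong (λ N → transpose (transpose M ·ₘ N)) (sym (adj-transpose M)) ⟩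
  transpose (transpose M ·ₘ adj (transpose M))
    ≡⟨ cong transpose (·ₘ-adj (transpose M)) ⟩
  scalar (det (transpose M))
    ≡⟨ cong scalar (det-transpose M) ⟩
  scalar (det M)
    ∎
  where open ≡-Reasoning

unimodularAut : (M : M3) → det M ≡ + 1 → IntAffAut
unimodularAut M det≡1 = intAffAut M (adj M) origin
  (trans (adj-·ₘ M) (cong scalar det≡1))
  (trans (·ₘ-adj M) (cong scalar det≡1))

+ᵥ-origin : ∀ v → v +ᵥ origin ≡ v
+ᵥ-origin (v3 a b c) = v3-cong (+-identityʳ a) (+-identityʳ b) (+-identityʳ c)

apply-unimodularAut : ∀ M det≡1 p → apply (unimodularAut M det≡1) p ≡ M ·ᵥ p
apply-unimodularAut M _ p = +ᵥ-origin (M ·ᵥ p)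

·ᵥ-origin : ∀ M → M ·ᵥ origin ≡ origin
·ᵥ-origin (m3 r₁ r₂ r₃) = v3-cong (dot-origin r₁) (dot-origin r₂) (dot-origin r₃)

·ᵥ-e₁ : ∀ M → M ·ᵥ e₁ ≡ col₁ M
·ᵥ-e₁ (m3 r₁ r₂ r₃) = v3-cong (dot-e₁ r₁) (dot-e₁ r₂) (dot-e₁ r₃)

·ᵥ-e₂ : ∀ M → M ·ᵥ e₂ ≡ col₂ M
·ᵥ-e₂ (m3 r₁ r₂ r₃) = v3-cong (dot-e₂ r₁) (dot-e₂ r₂) (dot-e₂ r₃)

≅ᵢₐ-fromUnimodular : ∀ M → det M ≡ + 1 → ∀ {p q} → (∀ i → M ·ᵥ p i ≡ q i) →
                     pyramid origin p ≅ᵢₐ pyramid origin q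
≅ᵢₐ-fromUnimodular M det≡1 Mp≡q =
  unimodularAut M det≡1 ,
  trans (apply-unimodularAut M det≡1 origin) (·ᵥ-origin M) ,
  id ,
  λ i → trans (apply-unimodularAut M det≡1 _) (Mp≡q i)

module _ (ξ r : ℤ) where

  P-to-T : M3
  P-to-T = m3 (v3 (+ 1 + ξ) ξ (- ξ))
              (v3 (r - + 1) (r - + 1) (+ 2 - r))
              (v3 (- r) (- r) (r - + 1))

  det-P-to-T : det P-to-T ≡ + 1
  det-P-to-T = identity ξ r
    where
    identity : ∀ ξ r →
      (+ 1 + ξ) ℤ.* ((r - + 1) ℤ.* (r - + 1) - (+ 2 - r) ℤ.* (- r)) +
      ξ ℤ.* ((+ 2 - r) ℤ.* (- r) - (r - + 1) ℤ.* (r - + 1)) +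
      (- ξ) ℤ.* ((r - + 1) ℤ.* (- r) - (r - + 1) ℤ.* (- r)) ≡ + 1
    identity = solve-∀

  P-to-T-base : ∀ i → P-to-T ·ᵥ base P[ ξ , r ] i ≡ base T[ ξ , + 1 , r ] i
  P-to-T-base zero             = ·ᵥ-e₂ P-to-T
  P-to-T-base (suc zero)       = ·ᵥ-e₁ P-to-T
  P-to-T-base (suc (suc zero)) = v3-cong (identity₁ ξ r) (identity₂ ξ r) (identity₃ ξ r)
    where
    identity₁ : ∀ ξ r → (+ 1 + ξ) ℤ.* ξ + ξ ℤ.* (r - ξ) + (- ξ) ℤ.* r ≡ ξ
    identity₁ = solve-∀
    identity₂ : ∀ ξ r → (r - + 1) ℤ.* ξ + (r - + 1) ℤ.* (r - ξ) + (+ 2 - r) ℤ.* r ≡ r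
    identity₂ = solve-∀
    identity₃ : ∀ ξ r → (- r) ℤ.* ξ + (- r) ℤ.* (r - ξ) + (r - + 1) ℤ.* r ≡ - r
    identity₃ = solve-∀

P≅ᵢₐT : ∀ ξ r → P[ ξ , r ] ≅ᵢₐ T[ ξ , + 1 , r ]
P≅ᵢₐT ξ r = ≅ᵢₐ-fromUnimodular (P-to-T ξ r) (det-P-to-T ξ r) (P-to-T-base ξ r)

mainTheorem5 : (ξ r : ℕ) → Coprime ξ r → 2 ≤ r → 1 ≤ ξ → 2 * ξ ≤ r →
    P[ + ξ , + r ] ≅ᵢₐ T[ + ξ , + 1 , + r ]
mainTheorem5 ξ r _ _ _ _ = P≅ᵢₐT (+ ξ) (+ r)
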